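{- Let $L$ be a frame. There is a bijection between the sublocales $L_j$ of $L$ (i.e. nuclei $j$ on $L$) such that $L_j$ is an overlap algebra, and the join-preserving maps $L\to\Omega$.
   Context: Work constructively (intuitionistic logic, no choice). $\Omega=\mathrm{Pow}(1)$ is the frame of truth values. A nucleus on a frame $L$ is a function $j:L\to L$ with $x\leq j(x)=j(j(x))$ and $j(x\wedge y)=j(x)\wedge j(y)$; the corresponding sublocale is the frame $L_j=\{jx\mid x\in L\}$ with the order of $L$. A positivity predicate on a complete lattice $L$ is a unary predicate $\mathrm{Pos}$ such that: (i) $\mathrm{Pos}(x)$ and $x\leq y$ imply $\mathrm{Pos}(y)$; (ii) $\mathrm{Pos}(\bigvee X)$ implies $\mathrm{Pos}(x)$ for some $x\in X$; (iii) if $\mathrm{Pos}(x)\Rightarrow x\leq y$, then $x\leq y$. An overlap algebra is a frame with a positivity predicate such that for all $x,y$: if $\forall z\,(\mathrm{Pos}(z\wedge x)\Rightarrow\mathrm{Pos}(z\wedge y))$ then $x\leq y$. -}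

module Defs where

open import Level using (Level; suc)
open import Data.Product using (Σ; _×_; _,_; proj₁; proj₂)
open import Function.Bundles using (_⇔_; Equivalence)
open import Relation.Binary.Bundles using (Setoid)
open import Relation.Binary.Structures using (IsEquivalence)
open import Function.Properties.Equivalence using () renaming (refl to ⇔-refl; sym to ⇔-sym; trans to ⇔-trans)

record Frame (ℓ : Level) : Set (suc ℓ) where
  infix 4 _≤_ _≈_
  infixr 7 _∧_
  field
    Carrier : Set ℓ
    _≤_     : Carrier → Carrier → Set ℓ
    ≤-refl  : ∀ {x} → x ≤ x
    ≤-trans : ∀ {x y z} → x ≤ y → y ≤ z → x ≤ z
    ⊤       : Carrier
    ⊤-max   : ∀ {x} → x ≤ ⊤
    _∧_     : Carrier → Carrier → Carrier
    ∧-lbˡ   : ∀ {x y} → x ∧ y ≤ x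
    ∧-lbʳ   : ∀ {x y} → x ∧ y ≤ y
    ∧-glb   : ∀ {x y z} → z ≤ x → z ≤ y → z ≤ x ∧ y
    ⋁       : {I : Set ℓ} → (I → Carrier) → Carrier
    ⋁-ub    : ∀ {I : Set ℓ} (g : I → Carrier) (i : I) → g i ≤ ⋁ g
    ⋁-lub   : ∀ {I : Set ℓ} (g : I → Carrier) {y} → (∀ i → g i ≤ y) → ⋁ g ≤ y
    distrib : ∀ {I : Set ℓ} (x : Carrier) (g : I → Carrier) →
              x ∧ ⋁ g ≤ ⋁ (λ i → x ∧ g i)

  _≈_ : Carrier → Carrier → Set ℓ
  x ≈ y = (x ≤ y) × (y ≤ x)

module _ {ℓ : Level} (L : Frame ℓ) where
  open Frame L

  record IsNucleus (j : Carrier → Carrier) : Set ℓ where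
    field
      cong       : ∀ {x y} → x ≈ y → j x ≈ j y
      inflat     : ∀ x → x ≤ j x
      idem       : ∀ x → j (j x) ≈ j x
      meet-pres  : ∀ x y → j (x ∧ y) ≈ (j x ∧ j y)

module _ {ℓ : Level} (L : Frame ℓ) where
  open Frame L

  record IsPositivity (Pos : Carrier → Set ℓ) : Set (suc ℓ) where
    field
      pos-mono  : ∀ {x y} → Pos x → x ≤ y → Pos y
      pos-join  : ∀ {I : Set ℓ} (g : I → Carrier) → Pos (⋁ g) → Σ I (λ i → Pos (g i))
      pos-le    : ∀ {x y} → (Pos x → x ≤ y) → x ≤ y

  record IsOverlapAlgebra (Pos : Carrier → Set ℓ) : Set (suc ℓ) where
    field
      isPositivity : IsPositivity Pos
      overlap-ax   : ∀ {x y} → (∀ z → Pos (z ∧ x) → Pos (z ∧ y)) → x ≤ y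

-- The sublocale L_j = { j x ∣ x ∈ L } with the order of L.  An element
-- j x of L_j is represented by (any) x ∈ L, so the carrier is that of L
-- and the order is  x ≤ⱼ y := j x ≤ j y.  Meets are those of L,
-- top is j ⊤, and the join of a family (j (g i)) in L_j is j (⋁ g).

module _ {ℓ : Level} (L : Frame ℓ) where
  open Frame L

  private
    mono : (j : Carrier → Carrier) → IsNucleus L j → ∀ {x y} → x ≤ y → j x ≤ j y
    mono j n {x} {y} x≤y =
      ≤-trans (proj₁ (IsNucleus.cong n (∧-glb ≤-refl x≤y , ∧-lbˡ)))
        (≤-trans (proj₁ (IsNucleus.meet-pres n x y)) ∧-lbʳ)

  sublocale : (j : Carrier → Carrier) → IsNucleus L j → Frame ℓ
  sublocale j n = record
    { Carrier = Carrier
    ; _≤_     = λ x y → j x ≤ j y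
    ; ≤-refl  = ≤-refl
    ; ≤-trans = ≤-trans
    ; ⊤       = ⊤
    ; ⊤-max   = mono j n ⊤-max
    ; _∧_     = _∧_
    ; ∧-lbˡ   = mono j n ∧-lbˡ
    ; ∧-lbʳ   = mono j n ∧-lbʳ
    ; ∧-glb   = λ p q → ≤-trans (∧-glb p q) (proj₂ (IsNucleus.meet-pres n _ _))
    ; ⋁       = ⋁
    ; ⋁-ub    = λ g i → mono j n (⋁-ub g i)
    ; ⋁-lub   = λ g {y} h →
        ≤-trans (mono j n (⋁-lub g (λ i → ≤-trans (IsNucleus.inflat n (g i)) (h i))))
                (proj₁ (IsNucleus.idem n y))
    ; distrib = λ x g → mono j n (distrib x g)
    }

module _ {ℓ : Level} (L : Frame ℓ) where
  open Frame L

  record OverlapNucleus : Set (suc ℓ) where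
    field
      j         : Carrier → Carrier
      isNucleus : IsNucleus L j
      Pos       : Carrier → Set ℓ
      isOverlap : IsOverlapAlgebra (sublocale L j isNucleus) Pos

  OverlapNucleusSetoid : Setoid (suc ℓ) ℓ
  OverlapNucleusSetoid = record
    { Carrier = OverlapNucleus
    ; _≈_ = λ a b → ∀ x → OverlapNucleus.j a x ≈ OverlapNucleus.j b x
    ; isEquivalence = record
      { refl  = λ x → ≤-refl , ≤-refl
      ; sym   = λ p x → proj₂ (p x) , proj₁ (p x)
      ; trans = λ p q x → ≤-trans (proj₁ (p x)) (proj₁ (q x))
                        , ≤-trans (proj₂ (q x)) (proj₂ (p x))
      }
    }

  -- Join-preserving maps L → Ω, where Ω = Pow(1) is represented by
  -- types in Set ℓ (truth values) up to logical equivalence, and the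
  -- join of a family of truth values is its Σ-type (existential).
  record JoinPreservingToΩ : Set (suc ℓ) where
    field
      f        : Carrier → Set ℓ
      f-cong   : ∀ {x y} → x ≈ y → f x ⇔ f y
      f-joins  : ∀ {I : Set ℓ} (g : I → Carrier) → f (⋁ g) ⇔ Σ I (λ i → f (g i))

  JoinPreservingSetoid : Setoid (suc ℓ) ℓ
  JoinPreservingSetoid = record
    { Carrier = JoinPreservingToΩ
    ; _≈_ = λ a b → ∀ x → JoinPreservingToΩ.f a x ⇔ JoinPreservingToΩ.f b x
    ; isEquivalence = record
      { refl  = λ x → ⇔-refl
      ; sym   = λ p x → ⇔-sym (p x)
      ; trans = λ p q x → ⇔-trans (p x) (q x)
      }
    }

module Submission where

-- Both directions go through the "refinement" relation of a predicate P,
--     x ≼ y  :=  ∀ z → P (z ∧ x) → P (z ∧ y)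
-- (every z meeting x positively meets y positively).
--   * An overlap nucleus j is sent to its positivity predicate, which is a
--     join-preserving map L → Ω (joins in L_j are j-images of joins in L).
--   * A join-preserving f is sent to  J y := ⋁ { x ∣ x ≼ y }  (for P = f).
--     Join preservation plus distributivity give J y ≼ y, hence the Galois
--     property  x ≤ J y ⇔ x ≼ y;  from it J is a nucleus, and f is a
--     positivity predicate on L_J satisfying the overlap axiom.
-- The round trip f ↦ J ↦ f is the identity on the nose.  For the other one,
-- the overlap axiom and monotonicity of Pos show  x ≼ y ⇔ j x ≤ j y  in an
-- overlap algebra L_j, so the nucleus induced by Pos is j again.  Well
-- definedness on the setoids uses that a positivity predicate on a frame
-- is unique.

open import Defs
open import Level using (Level; Lift; lift)
open import Data.Bool using (Bool; true; false)
open import Data.Product using (Σ; _,_; proj₁; proj₂)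
open import Function.Bundles using (Inverse; Equivalence; mk⇔; _⇔_)
open import Function.Properties.Equivalence using () renaming (refl to ⇔-refl; sym to ⇔-sym)
open import Function.Definitions using (Inverseˡ; Inverseʳ)
open import Relation.Binary.Bundles using (Setoid)
import Function.Consequences.Setoid

-- A positivity predicate on any frame is unique: if Q x then x lies below
-- the join of the family "x, indexed by proofs of Q x", which is positive
-- when P x is, so one of its (proof-)indices exists.
positivity-unique : {ℓ : Level} (M : Frame ℓ) {P Q : Frame.Carrier M → Set ℓ} →
  IsPositivity M P → IsPositivity M Q → ∀ {x} → P x → Q x
positivity-unique M {Q = Q} isPosP isPosQ {x} Px =
  proj₁ (IsPositivity.pos-join isPosP x-if-Q (IsPositivity.pos-mono isPosP Px x≤⋁))
  where
    open Frame M
    x-if-Q : Q x → Carrier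
    x-if-Q _ = x
    x≤⋁ : x ≤ ⋁ x-if-Q
    x≤⋁ = IsPositivity.pos-le isPosQ (⋁-ub x-if-Q)

module _ {ℓ : Level} (L : Frame ℓ) where
  open Frame L

  ∧-mono : ∀ {x x′ y y′} → x ≤ x′ → y ≤ y′ → x ∧ y ≤ x′ ∧ y′
  ∧-mono p q = ∧-glb (≤-trans ∧-lbˡ p) (≤-trans ∧-lbʳ q)

  ∧-diag : ∀ {x} → x ≤ x ∧ x
  ∧-diag = ∧-glb ≤-refl ≤-refl

  ∧-assocˡ : ∀ {a b c} → (a ∧ b) ∧ c ≤ a ∧ (b ∧ c)
  ∧-assocˡ = ∧-glb (≤-trans ∧-lbˡ ∧-lbˡ) (∧-mono ∧-lbʳ ≤-refl)

  ∧-assocʳ : ∀ {a b c} → a ∧ (b ∧ c) ≤ (a ∧ b) ∧ c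
  ∧-assocʳ = ∧-glb (∧-mono ≤-refl ∧-lbˡ) (≤-trans ∧-lbʳ ∧-lbʳ)

  ∧-swapʳ : ∀ {a b c} → (a ∧ b) ∧ c ≤ (a ∧ c) ∧ b
  ∧-swapʳ = ∧-glb (∧-mono ∧-lbˡ ≤-refl) (≤-trans ∧-lbˡ ∧-lbʳ)

  nucleus-mono : ∀ {j} → IsNucleus L j → ∀ {x y} → x ≤ y → j x ≤ j y
  nucleus-mono {j} isN {x} {y} x≤y =
    ≤-trans (proj₁ (IsNucleus.cong isN (∧-glb ≤-refl x≤y , ∧-lbˡ)))
            (≤-trans (proj₁ (IsNucleus.meet-pres isN x y)) ∧-lbʳ)

  UpClosed : (Carrier → Set ℓ) → Set ℓ
  UpClosed P = ∀ {x y} → x ≤ y → P x → P y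

  -- A join-preserving map is monotone: if x ≤ y then y is the join of x and y.
  joinPreserving-upClosed : (F : JoinPreservingToΩ L) → UpClosed (JoinPreservingToΩ.f F)
  joinPreserving-upClosed F {x} {y} x≤y fx =
    Equivalence.to (f-cong (⋁-lub x,y below-y , ⋁-ub x,y (lift false)))
      (Equivalence.from (f-joins x,y) (lift true , fx))
    where
      open JoinPreservingToΩ F
      x,y : Lift ℓ Bool → Carrier
      x,y (lift true)  = x
      x,y (lift false) = y
      below-y : ∀ i → x,y i ≤ y
      below-y (lift true)  = x≤y
      below-y (lift false) = ≤-refl

  module Refinement (P : Carrier → Set ℓ) where

    infix 4 _≼_
    _≼_ : Carrier → Carrier → Set ℓ
    x ≼ y = ∀ z → P (z ∧ x) → P (z ∧ y)

    ≼-refl : ∀ {x} → x ≼ x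
    ≼-refl z Pzx = Pzx

    ≼-trans : ∀ {x y w} → x ≼ y → y ≼ w → x ≼ w
    ≼-trans x≼y y≼w z Pzx = y≼w z (x≼y z Pzx)

    module _ (up : UpClosed P) where

      ≤⇒≼ : ∀ {x y} → x ≤ y → x ≼ y
      ≤⇒≼ x≤y z = up (∧-mono ≤-refl x≤y)

      ≼-∧ : ∀ {x x′ y y′} → x ≼ y → x′ ≼ y′ → x ∧ x′ ≼ y ∧ y′
      ≼-∧ {x} {x′} {y} {y′} x≼y x′≼y′ z Pz∧xx′ =
        up ∧-assocˡ (x′≼y′ (z ∧ y) (up ∧-swapʳ
          (x≼y (z ∧ x′) (up (≤-trans ∧-assocʳ ∧-swapʳ) Pz∧xx′))))

      ≼-transport : ∀ {x y} → x ≼ y → P x → P y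
      ≼-transport {x} x≼y Px = up ∧-lbʳ (x≼y x (up ∧-diag Px))

      ≼-from-positive : ∀ {x y} → (P x → x ≼ y) → x ≼ y
      ≼-from-positive h z Pzx = h (up ∧-lbʳ Pzx) z Pzx

  ≼-respects-⇔ : ∀ {P Q : Carrier → Set ℓ} → (∀ x → P x ⇔ Q x) →
    ∀ {x y} → Refinement._≼_ P x y → Refinement._≼_ Q x y
  ≼-respects-⇔ P⇔Q x≼y z Qzx =
    Equivalence.to (P⇔Q _) (x≼y z (Equivalence.from (P⇔Q _) Qzx))

  module Induced (F : JoinPreservingToΩ L) where
    open JoinPreservingToΩ F
    open Refinement f public
    private up = joinPreserving-upClosed F

    J : Carrier → Carrier
    J y = ⋁ {I = Σ Carrier (_≼ y)} proj₁

    ≼⇒≤J : ∀ {x y} → x ≼ y → x ≤ J y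
    ≼⇒≤J {x} x≼y = ⋁-ub proj₁ (x , x≼y)

    -- J y itself refines y: if z ∧ J y is positive then, by distributivity
    -- and join preservation, so is z ∧ x for some x ≼ y.
    J≼ : ∀ {y} → J y ≼ y
    J≼ {y} z Pz∧Jy
      with Equivalence.to (f-joins (λ (i : Σ Carrier (_≼ y)) → z ∧ proj₁ i))
                          (up (distrib z proj₁) Pz∧Jy)
    ... | (x , x≼y) , Pzx = x≼y z Pzx

    ≤J⇒≼ : ∀ {x y} → x ≤ J y → x ≼ y
    ≤J⇒≼ x≤Jy = ≼-trans (≤⇒≼ up x≤Jy) J≼

    J-inflat : ∀ x → x ≤ J x
    J-inflat x = ≼⇒≤J ≼-refl

    ≼⇒J≤ : ∀ {x y} → x ≼ y → J x ≤ J y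
    ≼⇒J≤ x≼y = ≼⇒≤J (≼-trans J≼ x≼y)

    J≤⇒≼ : ∀ {x y} → J x ≤ J y → x ≼ y
    J≤⇒≼ {x} Jx≤Jy = ≤J⇒≼ (≤-trans (J-inflat x) Jx≤Jy)

    J-mono : ∀ {x y} → x ≤ y → J x ≤ J y
    J-mono x≤y = ≼⇒J≤ (≤⇒≼ up x≤y)

    J-idem : ∀ y → J (J y) ≤ J y
    J-idem y = ≼⇒≤J (≼-trans J≼ J≼)

    J-isNucleus : IsNucleus L J
    J-isNucleus = record
      { cong      = λ x≈y → J-mono (proj₁ x≈y) , J-mono (proj₂ x≈y)
      ; inflat    = J-inflat
      ; idem      = λ y → J-idem y , J-inflat (J y)
      ; meet-pres = λ x y → ∧-glb (J-mono ∧-lbˡ) (J-mono ∧-lbʳ)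
                          , ≼⇒≤J (≼-∧ up J≼ J≼)
      }

    -- In L_J the order  J x ≤ J y  is exactly  x ≼ y, which makes f a
    -- positivity predicate satisfying the overlap axiom.
    J-overlap : IsOverlapAlgebra (sublocale L J J-isNucleus) f
    J-overlap = record
      { isPositivity = record
        { pos-mono = λ fx Jx≤Jy → ≼-transport up (J≤⇒≼ Jx≤Jy) fx
        ; pos-join = λ g → Equivalence.to (f-joins g)
        ; pos-le   = λ h → ≼⇒J≤ (≼-from-positive up (λ fx → J≤⇒≼ (h fx)))
        }
      ; overlap-ax = ≼⇒J≤
      }

    overlapNucleus : OverlapNucleus L
    overlapNucleus = record
      { j = J ; isNucleus = J-isNucleus ; Pos = f ; isOverlap = J-overlap }

  induced-respects-⇔ : (F G : JoinPreservingToΩ L) →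
    (∀ x → JoinPreservingToΩ.f F x ⇔ JoinPreservingToΩ.f G x) →
    ∀ y → Induced.J F y ≤ Induced.J G y
  induced-respects-⇔ F G F⇔G y = Induced.≼⇒≤J G (≼-respects-⇔ F⇔G (Induced.J≼ F))

  positivityMap : OverlapNucleus L → JoinPreservingToΩ L
  positivityMap N = record
    { f       = Pos
    ; f-cong  = λ x≈y → mk⇔ (λ Px → pos-mono Px (j-mono (proj₁ x≈y)))
                            (λ Py → pos-mono Py (j-mono (proj₂ x≈y)))
    ; f-joins = λ g → mk⇔ (pos-join g) (λ (i , Pgi) → pos-mono Pgi (j-mono (⋁-ub g i)))
    }
    where
      open OverlapNucleus N
      open IsPositivity (IsOverlapAlgebra.isPositivity isOverlap)
      j-mono : ∀ {x y} → x ≤ y → j x ≤ j y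
      j-mono = nucleus-mono isNucleus

  overlapNucleus-pos-cong : (N M : OverlapNucleus L) →
    (∀ x → OverlapNucleus.j N x ≈ OverlapNucleus.j M x) →
    ∀ {x} → OverlapNucleus.Pos N x → OverlapNucleus.Pos M x
  overlapNucleus-pos-cong N M N≈M =
    positivity-unique (sublocale L (j M) (isNucleus M)) transported
      (IsOverlapAlgebra.isPositivity (isOverlap M))
    where
      open OverlapNucleus
      open IsPositivity (IsOverlapAlgebra.isPositivity (isOverlap N))
      fromM : ∀ {x y} → j M x ≤ j M y → j N x ≤ j N y
      fromM {x} {y} p = ≤-trans (proj₁ (N≈M x)) (≤-trans p (proj₂ (N≈M y)))
      toM : ∀ {x y} → j N x ≤ j N y → j M x ≤ j M y
      toM {x} {y} p = ≤-trans (proj₂ (N≈M x)) (≤-trans p (proj₁ (N≈M y)))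
      transported : IsPositivity (sublocale L (j M) (isNucleus M)) (Pos N)
      transported = record
        { pos-mono = λ Px p → pos-mono Px (fromM p)
        ; pos-join = pos-join
        ; pos-le   = λ h → toM (pos-le (λ Px → fromM (h Px)))
        }

  positivityMap-cong : (N M : OverlapNucleus L) →
    (∀ x → OverlapNucleus.j N x ≈ OverlapNucleus.j M x) →
    ∀ x → OverlapNucleus.Pos N x ⇔ OverlapNucleus.Pos M x
  positivityMap-cong N M N≈M x =
    mk⇔ (overlapNucleus-pos-cong N M N≈M)
        (overlapNucleus-pos-cong M N (λ y → proj₂ (N≈M y) , proj₁ (N≈M y)))

  induced-cong : (F G : JoinPreservingToΩ L) →
    (∀ x → JoinPreservingToΩ.f F x ⇔ JoinPreservingToΩ.f G x) →
    ∀ y → Induced.J F y ≈ Induced.J G y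
  induced-cong F G F⇔G y =
      induced-respects-⇔ F G F⇔G y
    , induced-respects-⇔ G F (λ x → ⇔-sym (F⇔G x)) y

  -- Pos induces the nucleus j back: J y ≤ j y by the overlap axiom applied
  -- to J y ≼ y, and j y ≤ J y because j y ≼ y by monotonicity of Pos.
  recover-nucleus : (N : OverlapNucleus L) →
    ∀ y → Induced.J (positivityMap N) y ≈ OverlapNucleus.j N y
  recover-nucleus N y =
    ≤-trans (inflat (J y)) (overlap-ax J≼) , ≼⇒≤J j≼
    where
      open OverlapNucleus N
      open IsNucleus isNucleus
      open IsOverlapAlgebra isOverlap
      open IsPositivity isPositivity
      open Induced (positivityMap N)
      -- j (z ∧ j y) = j z ∧ j y = j (z ∧ y)
      j≼ : j y ≼ y
      j≼ z Pz∧jy = pos-mono Pz∧jy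
        (≤-trans (proj₁ (meet-pres z (j y)))
          (≤-trans (∧-mono ≤-refl (proj₁ (idem y))) (proj₂ (meet-pres z y))))

-- The maps N ↦ Pos_N and F ↦ J_F are mutually inverse congruences:
-- F ↦ J_F ↦ Pos is the identity on the nose, N ↦ Pos_N ↦ J is
-- recover-nucleus.
proposition5p8 : {ℓ : Level} (L : Frame ℓ) →
    Inverse (OverlapNucleusSetoid L) (JoinPreservingSetoid L)
proposition5p8 L = record
  { to        = positivityMap L
  ; from      = Induced.overlapNucleus L
  ; to-cong   = λ {N} {M} → positivityMap-cong L N M
  ; from-cong = λ {F} {G} → induced-cong L F G
  ; inverse   = (λ {F} {N} → inverseˡ {F} {N}) , (λ {N} {F} → inverseʳ {N} {F})
  }
  where
    open Setoid (OverlapNucleusSetoid L) using () renaming (_≈_ to _≈ₙ_)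
    open Setoid (JoinPreservingSetoid L) using () renaming (_≈_ to _≈ₘ_)
    open Function.Consequences.Setoid (OverlapNucleusSetoid L) (JoinPreservingSetoid L)

    inverseˡ : Inverseˡ _≈ₙ_ _≈ₘ_ (positivityMap L) (Induced.overlapNucleus L)
    inverseˡ {F} {N} = strictlyInverseˡ⇒inverseˡ
      {f = positivityMap L} {f⁻¹ = Induced.overlapNucleus L}
      (λ {N} {M} → positivityMap-cong L N M) (λ F x → ⇔-refl) {F} {N}

    inverseʳ : Inverseʳ _≈ₙ_ _≈ₘ_ (positivityMap L) (Induced.overlapNucleus L)
    inverseʳ {N} {F} = strictlyInverseʳ⇒inverseʳ
      {f⁻¹ = Induced.overlapNucleus L} {f = positivityMap L}
      (λ {F} {G} → induced-cong L F G) (recover-nucleus L) {N} {F}
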